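{- Let $N_1,N_2>0$ and let $\mathbf B_1\subset\mathbf F_{N_1,2}$ and $\mathbf B_2\subset\mathbf F_{N_2,2}$ be $\mathbb Q$-subspaces with $\mathbf B_1\cap\mathbf B_2=\{0\}$. Then \[\dim_{\mathbb Q}\langle w_1\,\text{ш}\,w_2\mid w_1\in\mathbf B_1,\ w_2\in\mathbf B_2\rangle_{\mathbb Q}=\dim_{\mathbb Q}\mathbf B_1\cdot\dim_{\mathbb Q}\mathbf B_2.\]
   Context: $\mathbf F=\mathbb Q\langle z_3,z_5,z_7,\dots\rangle$ is the noncommutative polynomial algebra on generators $z_{2i+1}$ ($i\ge1$), the empty word being $1$. $\mathbf F_{N,r}$ is the $\mathbb Q$-span of the words $z_{n_1}\cdots z_{n_r}$ with $n_1+\cdots+n_r=N$ and all $n_i$ odd $\ge3$. The shuffle product ш is the bilinear product with $z_{n_1}\cdots z_{n_r}\,\text{ш}\,z_{n_{r+1}}\cdots z_{n_{r+s}}=\sum_\sigma z_{n_{\sigma^{ -1}(1)}}\cdots z_{n_{\sigma^{ -1}(r+s)}}$, summed over permutations $\sigma$ of $\{1,\dots,r+s\}$ with $\sigma(1)<\cdots<\sigma(r)$ and $\sigma(r+1)<\cdots<\sigma(r+s)$; it makes $\mathbf F$ a commutative algebra. -}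

module Defs where

open import Data.Nat as ℕ using (ℕ; _%_; _≤_; _<_)
open import Data.Rational as ℚ using (ℚ; 0ℚ)
open import Data.List as L using (List; []; _∷_; _++_; map; concatMap)
open import Data.List.Properties using (≡-dec)
open import Data.Nat.ListAction using (sum)
open import Data.List.Relation.Unary.All using (All)
open import Data.Vec as V using (Vec; lookup)
open import Data.Fin using (Fin)
open import Data.Product using (_×_; _,_; Σ; ∃)
open import Relation.Binary.PropositionalEquality using (_≡_; _≢_)
open import Relation.Nullary using (yes; no)
open import Level using (suc; zero)

-- Words in the letters z_n are represented by the list of their indices n.
Word : Set
Word = List ℕ

-- Elements of F = ℚ⟨z_3,z_5,…⟩ as finite formal ℚ-linear combinations of words.
Poly : Set
Poly = List (ℚ × Word)

_≟w_ : (u v : Word) → Relation.Nullary.Dec (u ≡ v)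
_≟w_ = ≡-dec ℕ._≟_

coeff : Poly → Word → ℚ
coeff [] w = 0ℚ
coeff ((q , u) ∷ p) w with u ≟w w
... | yes _ = q ℚ.+ coeff p w
... | no  _ = coeff p w

_≈_ : Poly → Poly → Set
p ≈ q = ∀ w → coeff p w ≡ coeff q w

0F : Poly
0F = []

_+F_ : Poly → Poly → Poly
p +F q = p ++ q

_·F_ : ℚ → Poly → Poly
c ·F p = map (λ { (q , w) → (c ℚ.* q , w) }) p

-- shuffle of two words, as the list (with multiplicity) of resulting words
shw : Word → Word → List Word
shw [] v = v ∷ []
shw (a ∷ u) [] = (a ∷ u) ∷ []
shw (a ∷ u) (b ∷ v) = map (a ∷_) (shw u (b ∷ v)) ++ map (b ∷_) (shw (a ∷ u) v)

_ш_ : Poly → Poly → Poly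
p ш q = concatMap (λ { (c , u) → concatMap (λ { (d , v) → map (λ w → (c ℚ.* d , w)) (shw u v) }) q }) p

-- admissible words of F_{N,r}: length r, all letters odd ≥ 3, weight N
Odd≥3 : ℕ → Set
Odd≥3 n = (n % 2 ≡ 1) × (3 ≤ n)

AdmWord : ℕ → ℕ → Word → Set
AdmWord N r w = (L.length w ≡ r) × All Odd≥3 w × (sum w ≡ N)

InF : ℕ → ℕ → Poly → Set
InF N r p = ∀ w → coeff p w ≢ 0ℚ → AdmWord N r w

record Subspace : Set₁ where
  field
    Mem     : Poly → Set
    resp    : ∀ {p q} → p ≈ q → Mem p → Mem q
    zero∈   : Mem 0F
    +∈      : ∀ {p q} → Mem p → Mem q → Mem (p +F q)
    ·∈      : ∀ c {p} → Mem p → Mem (c ·F p)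
open Subspace public

_⊆F[_,_] : Subspace → ℕ → ℕ → Set
B ⊆F[ N , r ] = ∀ p → Mem B p → InF N r p

lincomb : ∀ {k} → Vec ℚ k → Vec Poly k → Poly
lincomb V.[] V.[] = 0F
lincomb (c V.∷ cs) (v V.∷ vs) = (c ·F v) +F lincomb cs vs

LinIndep : ∀ {k} → Vec Poly k → Set
LinIndep {k} vs = ∀ (cs : Vec ℚ k) → lincomb cs vs ≈ 0F → ∀ i → lookup cs i ≡ 0ℚ

Spans : ∀ {k} → (Poly → Set) → Vec Poly k → Set
Spans {k} P vs = (∀ i → P (lookup vs i)) × (∀ p → P p → Σ (Vec ℚ k) λ cs → p ≈ lincomb cs vs)

HasDim : (Poly → Set) → ℕ → Set
HasDim P d = Σ (Vec Poly d) λ vs → LinIndep vs × Spans P vs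

ShSpan : Subspace → Subspace → Poly → Set
ShSpan B₁ B₂ p =
  Σ ℕ λ k → Σ (Vec ℚ k) λ cs → Σ (Vec Poly k) λ xs → Σ (Vec Poly k) λ ys →
    (∀ i → Mem B₁ (lookup xs i)) × (∀ i → Mem B₂ (lookup ys i)) ×
    (p ≈ lincomb cs (V.zipWith _ш_ xs ys))

-- Choose bases b₁ of B₁ and b₂ of B₂. By bilinearity of ш the d₁ d₂ shuffles b₁ᵢ ш b₂ⱼ span,
-- so the point is their independence. A vanishing combination can be grouped as Σᵢ b₁ᵢ ш yᵢ with
-- yᵢ ∈ B₂, and its coefficient at a word w is the sum of t(u, v) = Σᵢ coeff(b₁ᵢ, u) coeff(yᵢ, v)
-- over the ways of splitting w into complementary subwords u, v. Here t lives on two-letter words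
-- u, v of weights N₁, N₂, and the coefficients at four-letter words force t(u, v) = - t(v, u).
-- Consequently Σᵢ coeff(b₁ᵢ, u) yᵢ ∈ B₂ equals - Σᵢ coeff(yᵢ, u) b₁ᵢ ∈ B₁, so it is 0 because
-- B₁ ∩ B₂ = 0. Thus t = 0, and independence of b₁ and then of b₂ kills all coefficients.

module Submission where

open import Defs

open import Data.Nat as ℕ using (ℕ)
import Data.Nat.Properties as ℕₚ
open import Data.Nat.ListAction using (sum)
import Data.Integer as ℤ
open import Data.Rational as ℚ using (ℚ; 0ℚ; 1ℚ; _+_; _*_; -_)
import Data.Rational.Properties as ℚₚ
open import Data.Rational.Solver using (module +-*-Solver)
open import Data.List as List using (List; []; _∷_; _++_)
import Data.List.Properties as Listₚ
open import Data.Vec as Vec using (Vec; []; _∷_; lookup; _⊛*_)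
import Data.Vec.Properties as Vecₚ
open import Data.Fin using (zero; suc; combine; quotient; remainder)
import Data.Fin.Properties as Finₚ
open import Data.Product using (_×_; _,_; Σ; ∃; ∃₂; map₁; map₂; proj₁; proj₂; swap)
open import Data.Sum using (_⊎_; inj₁; inj₂)
open import Relation.Binary.PropositionalEquality hiding (resp)
open import Function using (_∘_)
open import Relation.Nullary using (Dec; yes; no)
open import Data.Empty using (⊥-elim)
open import Algebra.Bundles using (CommutativeMonoid)
import Algebra.Properties.CommutativeSemigroup as CommutativeSemigroupProperties

open CommutativeSemigroupProperties (CommutativeMonoid.commutativeSemigroup ℚₚ.+-0-commutativeMonoid)
  using () renaming (interchange to +-interchange)
open CommutativeSemigroupProperties (CommutativeMonoid.commutativeSemigroup ℚₚ.*-1-commutativeMonoid)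
  using () renaming (x∙yz≈y∙xz to x*yz≡y*xz)

∑ : {A : Set} → List A → (A → ℚ) → ℚ
∑ []       f = 0ℚ
∑ (x ∷ xs) f = f x + ∑ xs f

module _ {A : Set} where

  ∑-++ : (xs ys : List A) (f : A → ℚ) → ∑ (xs ++ ys) f ≡ ∑ xs f + ∑ ys f
  ∑-++ []       ys f = sym (ℚₚ.+-identityˡ _)
  ∑-++ (x ∷ xs) ys f = trans (cong (f x +_) (∑-++ xs ys f)) (sym (ℚₚ.+-assoc (f x) _ _))

  ∑-map : {B : Set} (g : B → A) (xs : List B) (f : A → ℚ) →
          ∑ (List.map g xs) f ≡ ∑ xs (λ x → f (g x))
  ∑-map g []       f = refl
  ∑-map g (x ∷ xs) f = cong (f (g x) +_) (∑-map g xs f)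

  ∑-cong : (xs : List A) {f g : A → ℚ} → (∀ x → f x ≡ g x) → ∑ xs f ≡ ∑ xs g
  ∑-cong []       f≗g = refl
  ∑-cong (x ∷ xs) f≗g = cong₂ _+_ (f≗g x) (∑-cong xs f≗g)

  ∑-zero : (xs : List A) {f : A → ℚ} → (∀ x → f x ≡ 0ℚ) → ∑ xs f ≡ 0ℚ
  ∑-zero []       f≗0 = refl
  ∑-zero (x ∷ xs) f≗0 = trans (cong₂ _+_ (f≗0 x) (∑-zero xs f≗0)) (ℚₚ.+-identityˡ 0ℚ)

  ∑-+ : (xs : List A) (f g : A → ℚ) → ∑ xs (λ x → f x + g x) ≡ ∑ xs f + ∑ xs g
  ∑-+ []       f g = sym (ℚₚ.+-identityˡ 0ℚ)
  ∑-+ (x ∷ xs) f g = trans (cong (f x + g x +_) (∑-+ xs f g)) (+-interchange (f x) (g x) _ _)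

  ∑-* : (xs : List A) (c : ℚ) (f : A → ℚ) → ∑ xs (λ x → c * f x) ≡ c * ∑ xs f
  ∑-* []       c f = sym (ℚₚ.*-zeroʳ c)
  ∑-* (x ∷ xs) c f = trans (cong (c * f x +_) (∑-* xs c f)) (sym (ℚₚ.*-distribˡ-+ c (f x) _))

δ : Word → Word → ℚ
δ u w with u ≟w w
... | yes _ = 1ℚ
... | no  _ = 0ℚ

δ-refl : ∀ u → δ u u ≡ 1ℚ
δ-refl u with u ≟w u
... | yes _   = refl
... | no  u≢u = ⊥-elim (u≢u refl)

δ-≢ : ∀ u w → u ≢ w → δ u w ≡ 0ℚ
δ-≢ u w u≢w with u ≟w w
... | yes u≡w = ⊥-elim (u≢w u≡w)
... | no  _   = refl

coeff-∷ : ∀ c u p w → coeff ((c , u) ∷ p) w ≡ c * δ u w + coeff p w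
coeff-∷ c u p w with u ≟w w
... | yes _ = cong (_+ coeff p w) (sym (ℚₚ.*-identityʳ c))
... | no  _ = sym (trans (cong (_+ coeff p w) (ℚₚ.*-zeroʳ c)) (ℚₚ.+-identityˡ _))

coeff-+F : ∀ p q w → coeff (p +F q) w ≡ coeff p w + coeff q w
coeff-+F []            q w = sym (ℚₚ.+-identityˡ _)
coeff-+F ((c , u) ∷ p) q w = begin
  coeff ((c , u) ∷ p +F q) w           ≡⟨ coeff-∷ c u (p +F q) w ⟩
  c * δ u w + coeff (p +F q) w         ≡⟨ cong (c * δ u w +_) (coeff-+F p q w) ⟩
  c * δ u w + (coeff p w + coeff q w)  ≡⟨ sym (ℚₚ.+-assoc (c * δ u w) (coeff p w) (coeff q w)) ⟩
  c * δ u w + coeff p w + coeff q w    ≡⟨ cong (_+ coeff q w) (sym (coeff-∷ c u p w)) ⟩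
  coeff ((c , u) ∷ p) w + coeff q w    ∎
  where open ≡-Reasoning

coeff-·F : ∀ c p w → coeff (c ·F p) w ≡ c * coeff p w
coeff-·F c []            w = sym (ℚₚ.*-zeroʳ c)
coeff-·F c ((d , u) ∷ p) w = begin
  coeff (c ·F ((d , u) ∷ p)) w          ≡⟨ coeff-∷ (c * d) u (c ·F p) w ⟩
  c * d * δ u w + coeff (c ·F p) w      ≡⟨ cong₂ _+_ (ℚₚ.*-assoc c d _) (coeff-·F c p w) ⟩
  c * (d * δ u w) + c * coeff p w       ≡⟨ sym (ℚₚ.*-distribˡ-+ c _ _) ⟩
  c * (d * δ u w + coeff p w)           ≡⟨ cong (c *_) (sym (coeff-∷ d u p w)) ⟩
  c * coeff ((d , u) ∷ p) w             ∎
  where open ≡-Reasoning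

dot : ∀ {n} → Vec ℚ n → Vec ℚ n → ℚ
dot []       []       = 0ℚ
dot (x ∷ xs) (y ∷ ys) = x * y + dot xs ys

coeffsAt : ∀ {n} → Word → Vec Poly n → Vec ℚ n
coeffsAt w = Vec.map (λ p → coeff p w)

dot-comm : ∀ {n} (xs ys : Vec ℚ n) → dot xs ys ≡ dot ys xs
dot-comm []       []       = refl
dot-comm (x ∷ xs) (y ∷ ys) = cong₂ _+_ (ℚₚ.*-comm x y) (dot-comm xs ys)

dot-zeroˡ : ∀ {n} (ys : Vec ℚ n) → dot (Vec.replicate n 0ℚ) ys ≡ 0ℚ
dot-zeroˡ []       = refl
dot-zeroˡ (y ∷ ys) = trans (cong₂ _+_ (ℚₚ.*-zeroˡ y) (dot-zeroˡ ys)) (ℚₚ.+-identityˡ 0ℚ)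

dot-distribʳ : ∀ {n} (xs xs′ ys : Vec ℚ n) →
               dot (Vec.zipWith _+_ xs xs′) ys ≡ dot xs ys + dot xs′ ys
dot-distribʳ []       []         []       = sym (ℚₚ.+-identityˡ 0ℚ)
dot-distribʳ (x ∷ xs) (x′ ∷ xs′) (y ∷ ys) =
  trans (cong₂ _+_ (ℚₚ.*-distribʳ-+ y x x′) (dot-distribʳ xs xs′ ys))
        (+-interchange (x * y) (x′ * y) _ _)

dot-scaleˡ : ∀ {n} c (xs ys : Vec ℚ n) → dot (Vec.map (c *_) xs) ys ≡ c * dot xs ys
dot-scaleˡ c []       []       = sym (ℚₚ.*-zeroʳ c)
dot-scaleˡ c (x ∷ xs) (y ∷ ys) =
  trans (cong₂ _+_ (ℚₚ.*-assoc c x y) (dot-scaleˡ c xs ys)) (sym (ℚₚ.*-distribˡ-+ c _ _))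

dot-≢0 : ∀ {n} (xs ys : Vec ℚ n) → dot xs ys ≢ 0ℚ →
         ∃ λ i → lookup xs i ≢ 0ℚ × lookup ys i ≢ 0ℚ
dot-≢0 []       []       ≢0 = ⊥-elim (≢0 refl)
dot-≢0 (x ∷ xs) (y ∷ ys) ≢0 with x * y ℚ.≟ 0ℚ
... | no xy≢0 = zero , (λ x≡0 → xy≢0 (trans (cong (_* y) x≡0) (ℚₚ.*-zeroˡ y)))
                     , (λ y≡0 → xy≢0 (trans (cong (x *_) y≡0) (ℚₚ.*-zeroʳ x)))
... | yes xy≡0
  with dot-≢0 xs ys (λ rest≡0 → ≢0 (trans (cong₂ _+_ xy≡0 rest≡0) (ℚₚ.+-identityˡ 0ℚ)))
...   | i , xᵢ≢0 , yᵢ≢0 = suc i , xᵢ≢0 , yᵢ≢0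

coeff-lincomb-∷ : ∀ {n} c v (cs : Vec ℚ n) vs w →
                  coeff (lincomb (c ∷ cs) (v ∷ vs)) w ≡ c * coeff v w + coeff (lincomb cs vs) w
coeff-lincomb-∷ c v cs vs w = trans (coeff-+F (c ·F v) (lincomb cs vs) w) (cong (_+ _) (coeff-·F c v w))

coeff-lincomb : ∀ {n} (cs : Vec ℚ n) (vs : Vec Poly n) w →
                coeff (lincomb cs vs) w ≡ dot cs (coeffsAt w vs)
coeff-lincomb []       []       w = refl
coeff-lincomb (c ∷ cs) (v ∷ vs) w =
  trans (coeff-lincomb-∷ c v cs vs w) (cong (c * coeff v w +_) (coeff-lincomb cs vs w))

lincomb-++ : ∀ {m n} (cs : Vec ℚ m) (ds : Vec ℚ n) vs ws →
             lincomb (cs Vec.++ ds) (vs Vec.++ ws) ≡ lincomb cs vs +F lincomb ds ws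
lincomb-++ []       ds []       ws = refl
lincomb-++ (c ∷ cs) ds (v ∷ vs) ws =
  trans (cong ((c ·F v) +F_) (lincomb-++ cs ds vs ws)) (sym (Listₚ.++-assoc (c ·F v) _ _))

lincomb∈ : (B : Subspace) {n : ℕ} (cs : Vec ℚ n) (vs : Vec Poly n) →
           (∀ i → Mem B (lookup vs i)) → Mem B (lincomb cs vs)
lincomb∈ B []       []       vs∈B = zero∈ B
lincomb∈ B (c ∷ cs) (v ∷ vs) vs∈B = +∈ B (·∈ B c (vs∈B zero)) (lincomb∈ B cs vs (vs∈B ∘ suc))

InSpan : ∀ {n} → Vec Poly n → Poly → Set
InSpan {n} vs p = Σ (Vec ℚ n) λ cs → p ≈ lincomb cs vs

span : ∀ {n} → Vec Poly n → Subspace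
span {n} vs = record
  { Mem   = InSpan vs
  ; resp  = λ p≈q (cs , p≈) → cs , λ w → trans (sym (p≈q w)) (p≈ w)
  ; zero∈ = Vec.replicate n 0ℚ , λ w →
      sym (trans (coeff-lincomb (Vec.replicate n 0ℚ) vs w) (dot-zeroˡ (coeffsAt w vs)))
  ; +∈    = λ {p} {q} (cs , p≈) (ds , q≈) → Vec.zipWith _+_ cs ds , λ w → begin
      coeff (p +F q) w                                 ≡⟨ coeff-+F p q w ⟩
      coeff p w + coeff q w                            ≡⟨ cong₂ _+_ (trans (p≈ w) (coeff-lincomb cs vs w))
                                                                    (trans (q≈ w) (coeff-lincomb ds vs w)) ⟩
      dot cs (coeffsAt w vs) + dot ds (coeffsAt w vs)  ≡⟨ sym (dot-distribʳ cs ds (coeffsAt w vs)) ⟩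
      dot (Vec.zipWith _+_ cs ds) (coeffsAt w vs)      ≡⟨ sym (coeff-lincomb (Vec.zipWith _+_ cs ds) vs w) ⟩
      coeff (lincomb (Vec.zipWith _+_ cs ds) vs) w     ∎
  ; ·∈    = λ c {p} (cs , p≈) → Vec.map (c *_) cs , λ w → begin
      coeff (c ·F p) w                          ≡⟨ coeff-·F c p w ⟩
      c * coeff p w                             ≡⟨ cong (c *_) (trans (p≈ w) (coeff-lincomb cs vs w)) ⟩
      c * dot cs (coeffsAt w vs)                ≡⟨ sym (dot-scaleˡ c cs (coeffsAt w vs)) ⟩
      dot (Vec.map (c *_) cs) (coeffsAt w vs)   ≡⟨ sym (coeff-lincomb (Vec.map (c *_) cs) vs w) ⟩
      coeff (lincomb (Vec.map (c *_) cs) vs) w  ∎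
  }
  where open ≡-Reasoning

lookup∈span : ∀ {n} (vs : Vec Poly n) i → Mem (span vs) (lookup vs i)
lookup∈span (v ∷ vs) zero = 1ℚ ∷ Vec.replicate _ 0ℚ , λ w → sym (begin
  coeff (lincomb (1ℚ ∷ Vec.replicate _ 0ℚ) (v ∷ vs)) w
    ≡⟨ coeff-lincomb (1ℚ ∷ Vec.replicate _ 0ℚ) (v ∷ vs) w ⟩
  1ℚ * coeff v w + dot (Vec.replicate _ 0ℚ) (coeffsAt w vs)
    ≡⟨ cong₂ _+_ (ℚₚ.*-identityˡ (coeff v w)) (dot-zeroˡ (coeffsAt w vs)) ⟩
  coeff v w + 0ℚ                                       ≡⟨ ℚₚ.+-identityʳ (coeff v w) ⟩
  coeff v w                                            ∎)
  where open ≡-Reasoning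
lookup∈span (v ∷ vs) (suc i) =
  let cs , vᵢ≈ = lookup∈span vs i in
  0ℚ ∷ cs , λ w → sym (begin
    coeff (lincomb (0ℚ ∷ cs) (v ∷ vs)) w  ≡⟨ coeff-+F (0ℚ ·F v) (lincomb cs vs) w ⟩
    coeff (0ℚ ·F v) w + coeff (lincomb cs vs) w
      ≡⟨ cong₂ _+_ (trans (coeff-·F 0ℚ v w) (ℚₚ.*-zeroˡ (coeff v w))) (sym (vᵢ≈ w)) ⟩
    0ℚ + coeff (lookup vs i) w            ≡⟨ ℚₚ.+-identityˡ (coeff (lookup vs i) w) ⟩
    coeff (lookup vs i) w                 ∎)
  where open ≡-Reasoning

-- Coefficients of a shuffle product

deshuffles : Word → List (Word × Word)
deshuffles []      = ([] , []) ∷ []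
deshuffles (x ∷ w) = List.map (map₁ (x ∷_)) (deshuffles w) ++ List.map (map₂ (x ∷_)) (deshuffles w)

shuffleCoeff : (Word → ℚ) → (Word → ℚ) → Word → ℚ
shuffleCoeff α β w = ∑ (deshuffles w) λ (u , v) → α u * β v

shuffleCoeff-∷ : ∀ α β x w →
  shuffleCoeff α β (x ∷ w) ≡ shuffleCoeff (α ∘ (x ∷_)) β w + shuffleCoeff α (β ∘ (x ∷_)) w
shuffleCoeff-∷ α β x w =
  trans (∑-++ (List.map (map₁ (x ∷_)) (deshuffles w)) _ _)
        (cong₂ _+_ (∑-map (map₁ (x ∷_)) (deshuffles w) _) (∑-map (map₂ (x ∷_)) (deshuffles w) _))

shuffleCoeff-cong : ∀ {α α′ β β′} → (∀ u → α u ≡ α′ u) → (∀ v → β v ≡ β′ v) →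
                    ∀ w → shuffleCoeff α β w ≡ shuffleCoeff α′ β′ w
shuffleCoeff-cong α≗α′ β≗β′ w = ∑-cong (deshuffles w) λ (u , v) → cong₂ _*_ (α≗α′ u) (β≗β′ v)

shuffleCoeff-+ˡ : ∀ α α′ β w →
  shuffleCoeff (λ u → α u + α′ u) β w ≡ shuffleCoeff α β w + shuffleCoeff α′ β w
shuffleCoeff-+ˡ α α′ β w =
  trans (∑-cong (deshuffles w) λ (u , v) → ℚₚ.*-distribʳ-+ (β v) (α u) (α′ u)) (∑-+ (deshuffles w) _ _)

shuffleCoeff-+ʳ : ∀ α β β′ w →
  shuffleCoeff α (λ v → β v + β′ v) w ≡ shuffleCoeff α β w + shuffleCoeff α β′ w
shuffleCoeff-+ʳ α β β′ w =
  trans (∑-cong (deshuffles w) λ (u , v) → ℚₚ.*-distribˡ-+ (α u) (β v) (β′ v)) (∑-+ (deshuffles w) _ _)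

shuffleCoeff-*ˡ : ∀ c α β w → shuffleCoeff (λ u → c * α u) β w ≡ c * shuffleCoeff α β w
shuffleCoeff-*ˡ c α β w = trans (∑-cong (deshuffles w) λ (u , v) → ℚₚ.*-assoc c (α u) (β v))
                                (∑-* (deshuffles w) c _)

shuffleCoeff-*ʳ : ∀ c α β w → shuffleCoeff α (λ v → c * β v) w ≡ c * shuffleCoeff α β w
shuffleCoeff-*ʳ c α β w = trans (∑-cong (deshuffles w) λ (u , v) → x*yz≡y*xz (α u) c (β v))
                                (∑-* (deshuffles w) c _)

shuffleCoeff-zeroˡ : ∀ β w → shuffleCoeff (λ _ → 0ℚ) β w ≡ 0ℚ
shuffleCoeff-zeroˡ β w = ∑-zero (deshuffles w) λ (u , v) → ℚₚ.*-zeroˡ (β v)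

shuffleCoeff-zeroʳ : ∀ α w → shuffleCoeff α (λ _ → 0ℚ) w ≡ 0ℚ
shuffleCoeff-zeroʳ α w = ∑-zero (deshuffles w) λ (u , v) → ℚₚ.*-zeroʳ (α u)

lead : Word → ℕ → ℚ
lead []      x = 0ℚ
lead (a ∷ _) x = δ List.[ a ] List.[ x ]

δ-∷ : ∀ u x w → δ u (x ∷ w) ≡ lead u x * δ (List.drop 1 u) w
δ-∷ []      x w = sym (ℚₚ.*-zeroˡ (δ [] w))
δ-∷ (a ∷ u) x w = by-cases (a ℕ.≟ x) (u ≟w w)
  where
  by-cases : Dec (a ≡ x) → Dec (u ≡ w) → δ (a ∷ u) (x ∷ w) ≡ lead (a ∷ u) x * δ u w
  by-cases (yes refl) (yes refl) =
    trans (δ-refl (a ∷ u)) (sym (cong₂ _*_ (δ-refl List.[ a ]) (δ-refl u)))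
  by-cases (yes refl) (no u≢w)   =
    trans (δ-≢ (a ∷ u) (a ∷ w) (u≢w ∘ Listₚ.∷-injectiveʳ))
          (sym (trans (cong (lead (a ∷ u) a *_) (δ-≢ u w u≢w)) (ℚₚ.*-zeroʳ (lead (a ∷ u) a))))
  by-cases (no a≢x)   _          =
    trans (δ-≢ (a ∷ u) (x ∷ w) (a≢x ∘ Listₚ.∷-injectiveˡ))
          (sym (trans (cong (_* δ u w) (δ-≢ List.[ a ] List.[ x ] (a≢x ∘ Listₚ.∷-injectiveˡ)))
                      (ℚₚ.*-zeroˡ (δ u w))))

count : Word → List Word → ℚ
count w ws = ∑ ws λ z → δ z w

coeff-map-tag : ∀ c ws w → coeff (List.map (λ z → (c , z)) ws) w ≡ c * count w ws
coeff-map-tag c []       w = sym (ℚₚ.*-zeroʳ c)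
coeff-map-tag c (z ∷ ws) w =
  trans (coeff-∷ c z _ w)
        (trans (cong (c * δ z w +_) (coeff-map-tag c ws w)) (sym (ℚₚ.*-distribˡ-+ c _ _)))

count-map-∷ : ∀ a ws x w → count (x ∷ w) (List.map (a ∷_) ws) ≡ lead List.[ a ] x * count w ws
count-map-∷ a ws x w =
  trans (∑-map (a ∷_) ws _)
        (trans (∑-cong ws (λ z → δ-∷ (a ∷ z) x w)) (∑-* ws (lead List.[ a ] x) (λ z → δ z w)))

count-shuffle-[]ˡ : ∀ w v → count w (shw [] v) ≡ δ v w
count-shuffle-[]ˡ w v = ℚₚ.+-identityʳ (δ v w)

count-shuffle-[]ʳ : ∀ w u → count w (shw u []) ≡ δ u w
count-shuffle-[]ʳ w []      = ℚₚ.+-identityʳ (δ [] w)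
count-shuffle-[]ʳ w (a ∷ u) = ℚₚ.+-identityʳ (δ (a ∷ u) w)

count-shuffle-at-[] : ∀ u v → count [] (shw u v) ≡ δ u [] * δ v []
count-shuffle-at-[] []      v       = trans (ℚₚ.+-identityʳ (δ v [])) (sym (ℚₚ.*-identityˡ (δ v [])))
count-shuffle-at-[] (a ∷ u) []      = refl
count-shuffle-at-[] (a ∷ u) (b ∷ v) =
  trans (∑-++ (List.map (a ∷_) (shw u (b ∷ v))) _ _)
        (cong₂ _+_ (trans (∑-map (a ∷_) (shw u (b ∷ v)) _) (∑-zero (shw u (b ∷ v)) λ _ → refl))
                   (trans (∑-map (b ∷_) (shw (a ∷ u) v) _) (∑-zero (shw (a ∷ u) v) λ _ → refl)))

count-shuffle-∷ : ∀ u v x w → count (x ∷ w) (shw u v) ≡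
  lead u x * count w (shw (List.drop 1 u) v) + lead v x * count w (shw u (List.drop 1 v))
count-shuffle-∷ []      []      x w =
  sym (cong₂ _+_ (ℚₚ.*-zeroˡ (count w (shw [] []))) (ℚₚ.*-zeroˡ (count w (shw [] []))))
count-shuffle-∷ []      (b ∷ v) x w = begin
  count (x ∷ w) (shw [] (b ∷ v))   ≡⟨ count-shuffle-[]ˡ (x ∷ w) (b ∷ v) ⟩
  δ (b ∷ v) (x ∷ w)                 ≡⟨ δ-∷ (b ∷ v) x w ⟩
  lead (b ∷ v) x * δ v w            ≡⟨ sym (ℚₚ.+-identityˡ _) ⟩
  0ℚ + lead (b ∷ v) x * δ v w
    ≡⟨ sym (cong₂ _+_ (ℚₚ.*-zeroˡ (count w (shw [] (b ∷ v))))
                      (cong (lead (b ∷ v) x *_) (count-shuffle-[]ˡ w v))) ⟩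
  0ℚ * count w (shw [] (b ∷ v)) + lead (b ∷ v) x * count w (shw [] v)  ∎
  where open ≡-Reasoning
count-shuffle-∷ (a ∷ u) []      x w = begin
  count (x ∷ w) (shw (a ∷ u) [])   ≡⟨ count-shuffle-[]ʳ (x ∷ w) (a ∷ u) ⟩
  δ (a ∷ u) (x ∷ w)                 ≡⟨ δ-∷ (a ∷ u) x w ⟩
  lead (a ∷ u) x * δ u w            ≡⟨ sym (ℚₚ.+-identityʳ _) ⟩
  lead (a ∷ u) x * δ u w + 0ℚ
    ≡⟨ sym (cong₂ _+_ (cong (lead (a ∷ u) x *_) (count-shuffle-[]ʳ w u))
                      (ℚₚ.*-zeroˡ (count w (shw (a ∷ u) [])))) ⟩
  lead (a ∷ u) x * count w (shw u []) + 0ℚ * count w (shw (a ∷ u) [])  ∎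
  where open ≡-Reasoning
count-shuffle-∷ (a ∷ u) (b ∷ v) x w =
  trans (∑-++ (List.map (a ∷_) (shw u (b ∷ v))) _ _)
        (cong₂ _+_ (count-map-∷ a (shw u (b ∷ v)) x w) (count-map-∷ b (shw (a ∷ u) v) x w))

shuffleCoeff-δ-∷ : ∀ u v x w → shuffleCoeff (δ u) (δ v) (x ∷ w) ≡
  lead u x * shuffleCoeff (δ (List.drop 1 u)) (δ v) w + lead v x * shuffleCoeff (δ u) (δ (List.drop 1 v)) w
shuffleCoeff-δ-∷ u v x w =
  trans (shuffleCoeff-∷ (δ u) (δ v) x w)
        (cong₂ _+_ (trans (shuffleCoeff-cong {β = δ v} (δ-∷ u x) (λ _ → refl) w)
                          (shuffleCoeff-*ˡ (lead u x) (δ (List.drop 1 u)) (δ v) w))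
                   (trans (shuffleCoeff-cong {α = δ u} (λ _ → refl) (δ-∷ v x) w)
                          (shuffleCoeff-*ʳ (lead v x) (δ u) (δ (List.drop 1 v)) w)))

count-shuffle : ∀ w u v → count w (shw u v) ≡ shuffleCoeff (δ u) (δ v) w
count-shuffle []      u v = trans (count-shuffle-at-[] u v) (sym (ℚₚ.+-identityʳ _))
count-shuffle (x ∷ w) u v = begin
  count (x ∷ w) (shw u v)
    ≡⟨ count-shuffle-∷ u v x w ⟩
  lead u x * count w (shw (List.drop 1 u) v) + lead v x * count w (shw u (List.drop 1 v))
    ≡⟨ cong₂ _+_ (cong (lead u x *_) (count-shuffle w (List.drop 1 u) v))
                 (cong (lead v x *_) (count-shuffle w u (List.drop 1 v))) ⟩
  lead u x * shuffleCoeff (δ (List.drop 1 u)) (δ v) w + lead v x * shuffleCoeff (δ u) (δ (List.drop 1 v)) w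
    ≡⟨ sym (shuffleCoeff-δ-∷ u v x w) ⟩
  shuffleCoeff (δ u) (δ v) (x ∷ w)
    ∎
  where open ≡-Reasoning

coeff-concatMap : ∀ {A : Set} (g : A → Poly) (h : A → ℚ) xs w →
                  (∀ x → coeff (g x) w ≡ h x) → coeff (List.concatMap g xs) w ≡ ∑ xs h
coeff-concatMap g h []       w g≗h = refl
coeff-concatMap g h (x ∷ xs) w g≗h =
  trans (coeff-+F (g x) _ w) (cong₂ _+_ (g≗h x) (coeff-concatMap g h xs w g≗h))

shuffleCoeff-coeffˡ : ∀ p β w →
  shuffleCoeff (coeff p) β w ≡ ∑ p λ (c , u) → c * shuffleCoeff (δ u) β w
shuffleCoeff-coeffˡ []            β w = shuffleCoeff-zeroˡ β w
shuffleCoeff-coeffˡ ((c , u) ∷ p) β w =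
  trans (shuffleCoeff-cong {β = β} (coeff-∷ c u p) (λ _ → refl) w)
  (trans (shuffleCoeff-+ˡ (λ y → c * δ u y) (coeff p) β w)
         (cong₂ _+_ (shuffleCoeff-*ˡ c (δ u) β w) (shuffleCoeff-coeffˡ p β w)))

shuffleCoeff-coeffʳ : ∀ α q w →
  shuffleCoeff α (coeff q) w ≡ ∑ q λ (d , v) → d * shuffleCoeff α (δ v) w
shuffleCoeff-coeffʳ α []            w = shuffleCoeff-zeroʳ α w
shuffleCoeff-coeffʳ α ((d , v) ∷ q) w =
  trans (shuffleCoeff-cong {α = α} (λ _ → refl) (coeff-∷ d v q) w)
  (trans (shuffleCoeff-+ʳ α (λ y → d * δ v y) (coeff q) w)
         (cong₂ _+_ (shuffleCoeff-*ʳ d α (δ v) w) (shuffleCoeff-coeffʳ α q w)))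

coeff-ш : ∀ p q w → coeff (p ш q) w ≡ shuffleCoeff (coeff p) (coeff q) w
coeff-ш p q w = begin
  coeff (p ш q) w
    ≡⟨ coeff-concatMap _ _ p w (λ (c , u) →
         coeff-concatMap _ _ q w λ (d , v) → coeff-map-tag (c * d) (shw u v) w) ⟩
  ∑ p (λ (c , u) → ∑ q λ (d , v) → c * d * count w (shw u v))
    ≡⟨ ∑-cong p (λ (c , u) → trans (∑-cong q λ (d , v) → ℚₚ.*-assoc c d _) (∑-* q c _)) ⟩
  ∑ p (λ (c , u) → c * ∑ q λ (d , v) → d * count w (shw u v))
    ≡⟨ ∑-cong p (λ (c , u) → cong (c *_)
         (trans (∑-cong q λ (d , v) → cong (d *_) (count-shuffle w u v))
                (sym (shuffleCoeff-coeffʳ (δ u) q w)))) ⟩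
  ∑ p (λ (c , u) → c * shuffleCoeff (δ u) (coeff q) w)
    ≡⟨ sym (shuffleCoeff-coeffˡ p (coeff q) w) ⟩
  shuffleCoeff (coeff p) (coeff q) w
    ∎
  where open ≡-Reasoning

shuffleCoeff-lincombˡ : ∀ {n} (cs : Vec ℚ n) vs β w →
  shuffleCoeff (coeff (lincomb cs vs)) β w ≡ dot cs (Vec.map (λ v → shuffleCoeff (coeff v) β w) vs)
shuffleCoeff-lincombˡ []       []       β w = shuffleCoeff-zeroˡ β w
shuffleCoeff-lincombˡ (c ∷ cs) (v ∷ vs) β w =
  trans (shuffleCoeff-cong {β = β} (coeff-lincomb-∷ c v cs vs) (λ _ → refl) w)
  (trans (shuffleCoeff-+ˡ (λ y → c * coeff v y) (coeff (lincomb cs vs)) β w)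
         (cong₂ _+_ (shuffleCoeff-*ˡ c (coeff v) β w) (shuffleCoeff-lincombˡ cs vs β w)))

shuffleCoeff-lincombʳ : ∀ {n} (cs : Vec ℚ n) vs α w →
  shuffleCoeff α (coeff (lincomb cs vs)) w ≡ dot cs (Vec.map (λ v → shuffleCoeff α (coeff v) w) vs)
shuffleCoeff-lincombʳ []       []       α w = shuffleCoeff-zeroʳ α w
shuffleCoeff-lincombʳ (c ∷ cs) (v ∷ vs) α w =
  trans (shuffleCoeff-cong {α = α} (λ _ → refl) (coeff-lincomb-∷ c v cs vs) w)
  (trans (shuffleCoeff-+ʳ α (λ y → c * coeff v y) (coeff (lincomb cs vs)) w)
         (cong₂ _+_ (shuffleCoeff-*ʳ c α (coeff v) w) (shuffleCoeff-lincombʳ cs vs α w)))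

ш-cong : ∀ {p p′ q q′} → p ≈ p′ → q ≈ q′ → (p ш q) ≈ (p′ ш q′)
ш-cong {p} {p′} {q} {q′} p≈p′ q≈q′ w =
  trans (coeff-ш p q w) (trans (shuffleCoeff-cong p≈p′ q≈q′ w) (sym (coeff-ш p′ q′ w)))

ш-lincombˡ : ∀ {n} (cs : Vec ℚ n) vs q → (lincomb cs vs ш q) ≈ lincomb cs (Vec.map (_ш q) vs)
ш-lincombˡ cs vs q w = begin
  coeff (lincomb cs vs ш q) w
    ≡⟨ coeff-ш (lincomb cs vs) q w ⟩
  shuffleCoeff (coeff (lincomb cs vs)) (coeff q) w
    ≡⟨ shuffleCoeff-lincombˡ cs vs (coeff q) w ⟩
  dot cs (Vec.map (λ v → shuffleCoeff (coeff v) (coeff q) w) vs)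
    ≡⟨ cong (dot cs) (trans (Vecₚ.map-cong (λ v → sym (coeff-ш v q w)) vs) (Vecₚ.map-∘ _ _ vs)) ⟩
  dot cs (coeffsAt w (Vec.map (_ш q) vs))
    ≡⟨ sym (coeff-lincomb cs _ w) ⟩
  coeff (lincomb cs (Vec.map (_ш q) vs)) w
    ∎
  where open ≡-Reasoning

ш-lincombʳ : ∀ {n} (cs : Vec ℚ n) vs p → (p ш lincomb cs vs) ≈ lincomb cs (Vec.map (p ш_) vs)
ш-lincombʳ cs vs p w = begin
  coeff (p ш lincomb cs vs) w
    ≡⟨ coeff-ш p (lincomb cs vs) w ⟩
  shuffleCoeff (coeff p) (coeff (lincomb cs vs)) w
    ≡⟨ shuffleCoeff-lincombʳ cs vs (coeff p) w ⟩
  dot cs (Vec.map (λ v → shuffleCoeff (coeff p) (coeff v) w) vs)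
    ≡⟨ cong (dot cs) (trans (Vecₚ.map-cong (λ v → sym (coeff-ш p v w)) vs) (Vecₚ.map-∘ _ _ vs)) ⟩
  dot cs (coeffsAt w (Vec.map (p ш_) vs))
    ≡⟨ sym (coeff-lincomb cs _ w) ⟩
  coeff (lincomb cs (Vec.map (p ш_) vs)) w
    ∎
  where open ≡-Reasoning

products : ∀ {m n} → Vec Poly m → Vec Poly n → Vec Poly (m ℕ.* n)
products xs ys = Vec.map _ш_ xs ⊛* ys

lookup-products : ∀ {m n} (xs : Vec Poly m) (ys : Vec Poly n) i j →
                  lookup (products xs ys) (combine i j) ≡ lookup xs i ш lookup ys j
lookup-products xs ys i j =
  trans (Vecₚ.lookup-⊛* (Vec.map _ш_ xs) ys i j)
        (cong (λ f → f (lookup ys j)) (Vecₚ.lookup-map i _ш_ xs))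

ш∈span-products : ∀ {m n} (xs : Vec Poly m) (ys : Vec Poly n) {x y} →
                  Mem (span xs) x → Mem (span ys) y → Mem (span (products xs ys)) (x ш y)
ш∈span-products xs ys {x} {y} (α , x≈) (β , y≈) =
  resp P {lincomb α (Vec.map (_ш y) xs)} {x ш y}
    (λ w → sym (trans (ш-cong {x} {lincomb α xs} {y} {y} x≈ (λ _ → refl) w)
                      (ш-lincombˡ α xs y w)))
    (lincomb∈ P α _ λ i → subst (Mem P) (sym (Vecₚ.lookup-map i (_ш y) xs)) (row∈P i))
  where
  P : Subspace
  P = span (products xs ys)
  row∈P : ∀ i → Mem P (lookup xs i ш y)
  row∈P i =
    resp P {lincomb β (Vec.map (xᵢ ш_) ys)} {xᵢ ш y}
      (λ w → sym (trans (ш-cong {xᵢ} {xᵢ} {y} {lincomb β ys} (λ _ → refl) y≈ w)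
                        (ш-lincombʳ β ys xᵢ w)))
      (lincomb∈ P β _ λ j → subst (Mem P) (sym (Vecₚ.lookup-map j (xᵢ ш_) ys))
        (subst (Mem P) (lookup-products xs ys i j) (lookup∈span (products xs ys) (combine i j))))
    where xᵢ = lookup xs i

shuffleSum : ∀ {n} → Vec Poly n → Vec Poly n → Poly
shuffleSum []       []       = 0F
shuffleSum (x ∷ xs) (y ∷ ys) = (x ш y) +F shuffleSum xs ys

lincomb-products : ∀ {m n} (C : Vec (Vec ℚ n) m) (xs : Vec Poly m) (ys : Vec Poly n) →
  lincomb (Vec.concat C) (products xs ys) ≈ shuffleSum xs (Vec.map (λ r → lincomb r ys) C)
lincomb-products []      []       ys w = refl
lincomb-products (r ∷ C) (x ∷ xs) ys w = begin
  coeff (lincomb (r Vec.++ Vec.concat C) (Vec.map (x ш_) ys Vec.++ products xs ys)) w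
    ≡⟨ cong (λ p → coeff p w) (lincomb-++ r (Vec.concat C) (Vec.map (x ш_) ys) (products xs ys)) ⟩
  coeff (lincomb r (Vec.map (x ш_) ys) +F lincomb (Vec.concat C) (products xs ys)) w
    ≡⟨ coeff-+F (lincomb r (Vec.map (x ш_) ys)) _ w ⟩
  coeff (lincomb r (Vec.map (x ш_) ys)) w + coeff (lincomb (Vec.concat C) (products xs ys)) w
    ≡⟨ cong₂ _+_ (sym (ш-lincombʳ r ys x w)) (lincomb-products C xs ys w) ⟩
  coeff (x ш lincomb r ys) w + coeff (shuffleSum xs (Vec.map (λ r → lincomb r ys) C)) w
    ≡⟨ sym (coeff-+F (x ш lincomb r ys) _ w) ⟩
  coeff (shuffleSum (x ∷ xs) (Vec.map (λ r → lincomb r ys) (r ∷ C))) w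
    ∎
  where open ≡-Reasoning

coeff-shuffleSum : ∀ {n} (xs ys : Vec Poly n) w →
  coeff (shuffleSum xs ys) w ≡ ∑ (deshuffles w) λ (u , v) → dot (coeffsAt u xs) (coeffsAt v ys)
coeff-shuffleSum []       []       w = sym (∑-zero (deshuffles w) λ _ → refl)
coeff-shuffleSum (x ∷ xs) (y ∷ ys) w =
  trans (coeff-+F (x ш y) _ w)
  (trans (cong₂ _+_ (coeff-ш x y w) (coeff-shuffleSum xs ys w)) (sym (∑-+ (deshuffles w) _ _)))

∑-deshuffles-four : (t : Word → Word → ℚ) → (∀ u v → List.length u ≢ 2 → t u v ≡ 0ℚ) → ∀ a b c d →
  ∑ (deshuffles (a ∷ b ∷ c ∷ d ∷ [])) (λ (u , v) → t u v) ≡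
    (t (a ∷ b ∷ []) (c ∷ d ∷ []) + t (c ∷ d ∷ []) (a ∷ b ∷ []))
  + (t (a ∷ c ∷ []) (b ∷ d ∷ []) + t (b ∷ d ∷ []) (a ∷ c ∷ []))
  + (t (a ∷ d ∷ []) (b ∷ c ∷ []) + t (b ∷ c ∷ []) (a ∷ d ∷ []))
∑-deshuffles-four t off-diagonal a b c d =
  regroup (t (a ∷ b ∷ []) (c ∷ d ∷ [])) (t (a ∷ c ∷ []) (b ∷ d ∷ [])) (t (a ∷ d ∷ []) (b ∷ c ∷ []))
          (t (b ∷ c ∷ []) (a ∷ d ∷ [])) (t (b ∷ d ∷ []) (a ∷ c ∷ [])) (t (c ∷ d ∷ []) (a ∷ b ∷ []))
    (off-diagonal (a ∷ b ∷ c ∷ d ∷ []) [] λ ())     (off-diagonal (a ∷ b ∷ c ∷ []) (d ∷ []) λ ())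
    (off-diagonal (a ∷ b ∷ d ∷ []) (c ∷ []) λ ())   (off-diagonal (a ∷ c ∷ d ∷ []) (b ∷ []) λ ())
    (off-diagonal (a ∷ []) (b ∷ c ∷ d ∷ []) λ ())   (off-diagonal (b ∷ c ∷ d ∷ []) (a ∷ []) λ ())
    (off-diagonal (b ∷ []) (a ∷ c ∷ d ∷ []) λ ())   (off-diagonal (c ∷ []) (a ∷ b ∷ d ∷ []) λ ())
    (off-diagonal (d ∷ []) (a ∷ b ∷ c ∷ []) λ ())   (off-diagonal [] (a ∷ b ∷ c ∷ d ∷ []) λ ())
  where
  -- The left-hand side is the sum over the sixteen deshuffles of abcd, unfolded in the order in which
  -- deshuffles lists them; the zᵢ are the ten terms whose first half is not a two-letter word.
  open +-*-Solver
  regroup : ∀ {z₁ z₂ z₃ z₄ z₅ z₆ z₇ z₈ z₉ z₁₀} y₁ y₂ y₃ y₄ y₅ y₆ →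
    z₁ ≡ 0ℚ → z₂ ≡ 0ℚ → z₃ ≡ 0ℚ → z₄ ≡ 0ℚ → z₅ ≡ 0ℚ → z₆ ≡ 0ℚ → z₇ ≡ 0ℚ → z₈ ≡ 0ℚ → z₉ ≡ 0ℚ → z₁₀ ≡ 0ℚ →
    z₁ + (z₂ + (z₃ + (y₁ + (z₄ + (y₂ + (y₃ + (z₅ + (z₆ + (y₄ + (y₅ + (z₇ + (y₆ + (z₈ + (z₉ + (z₁₀ + 0ℚ)))))))))))))))
      ≡ (y₁ + y₆) + (y₂ + y₅) + (y₃ + y₄)
  regroup y₁ y₂ y₃ y₄ y₅ y₆ refl refl refl refl refl refl refl refl refl refl =
    solve 6 (λ y₁ y₂ y₃ y₄ y₅ y₆ →
      con 0ℚ :+ (con 0ℚ :+ (con 0ℚ :+ (y₁ :+ (con 0ℚ :+ (y₂ :+ (y₃ :+ (con 0ℚ :+ (con 0ℚ :+ (y₄ :+ (y₅ :+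
        (con 0ℚ :+ (y₆ :+ (con 0ℚ :+ (con 0ℚ :+ (con 0ℚ :+ con 0ℚ)))))))))))))))
      := (y₁ :+ y₆) :+ (y₂ :+ y₅) :+ (y₃ :+ y₄)) refl y₁ y₂ y₃ y₄ y₅ y₆

-- Antisymmetry in weight two

TwoLetter : ℕ → Word → Set
TwoLetter N u = (List.length u ≡ 2) × (sum u ≡ N)

two-letter-view : ∀ u → List.length u ≡ 2 → ∃₂ λ (a b : ℕ) → u ≡ a ∷ b ∷ []
two-letter-view (a ∷ b ∷ []) refl = a , b , refl

sum-pair : ∀ a b → sum (a ∷ b ∷ []) ≡ a ℕ.+ b
sum-pair a b = cong (a ℕ.+_) (ℕₚ.+-identityʳ b)

+-≢ˡ : ∀ x {y y′} → y ≢ y′ → x ℕ.+ y ≢ x ℕ.+ y′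
+-≢ˡ x y≢y′ = y≢y′ ∘ ℕₚ.+-cancelˡ-≡ x _ _

+-≢ʳ : ∀ {x x′} y → x ≢ x′ → x ℕ.+ y ≢ x′ ℕ.+ y
+-≢ʳ y x≢x′ = x≢x′ ∘ ℕₚ.+-cancelʳ-≡ y _ _

+-≢-cross : ∀ {x z} y → x ≢ z → x ℕ.+ y ≢ y ℕ.+ z
+-≢-cross {x} {z} y x≢z e = +-≢ʳ y x≢z (trans e (ℕₚ.+-comm y z))

x+x≡0⇒x≡0 : ∀ x → x + x ≡ 0ℚ → x ≡ 0ℚ
x+x≡0⇒x≡0 x x+x≡0 = trans (halve x) (trans (cong (ℚ.½ *_) x+x≡0) (ℚₚ.*-zeroʳ ℚ.½))
  where
  open +-*-Solver
  halve : ∀ x → x ≡ ℚ.½ * (x + x)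
  halve = solve 1 (λ x → x := con ℚ.½ :* (x :+ x)) refl

x+x+x≡0⇒x≡0 : ∀ {x y z} → x + y + z ≡ 0ℚ → y ≡ x → z ≡ x → x ≡ 0ℚ
x+x+x≡0⇒x≡0 {x} x+x+x≡0 refl refl =
  trans (third x) (trans (cong (⅓ *_) x+x+x≡0) (ℚₚ.*-zeroʳ ⅓))
  where
  ⅓ : ℚ
  ⅓ = ℤ.+ 1 ℚ./ 3
  open +-*-Solver
  third : ∀ x → x ≡ ⅓ * (x + x + x)
  third = solve 1 (λ x → x := con ⅓ :* (x :+ x :+ x)) refl

x+x+0≡0⇒x≡0 : ∀ {x y z} → x + y + z ≡ 0ℚ → y ≡ x → z ≡ 0ℚ → x ≡ 0ℚ
x+x+0≡0⇒x≡0 {x} x+x+0≡0 refl refl =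
  x+x≡0⇒x≡0 x (trans (sym (ℚₚ.+-identityʳ (x + x))) x+x+0≡0)

0+x+x≡0⇒x≡0 : ∀ {x y z} → x + y + z ≡ 0ℚ → x ≡ 0ℚ → z ≡ y → y ≡ 0ℚ
0+x+x≡0⇒x≡0 {y = y} 0+y+y≡0 refl refl =
  x+x≡0⇒x≡0 y (trans (cong (_+ y) (sym (ℚₚ.+-identityˡ y))) 0+y+y≡0)

x+0+0≡0⇒x≡0 : ∀ {x y z} → x + y + z ≡ 0ℚ → y ≡ 0ℚ → z ≡ 0ℚ → x ≡ 0ℚ
x+0+0≡0⇒x≡0 {x} x+0+0≡0 refl refl =
  trans (sym (trans (ℚₚ.+-identityʳ (x + 0ℚ)) (ℚₚ.+-identityʳ x))) x+0+0≡0

x+y≡0⇒x≡-1*y : ∀ x y → x + y ≡ 0ℚ → x ≡ - 1ℚ * y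
x+y≡0⇒x≡-1*y x y x+y≡0 =
  trans (shift x y) (trans (cong (_+ - 1ℚ * y) x+y≡0) (ℚₚ.+-identityˡ _))
  where
  open +-*-Solver
  shift : ∀ x y → x ≡ (x + y) + - 1ℚ * y
  shift = solve 2 (λ x y → x := (x :+ y) :+ con (- 1ℚ) :* y) refl

module Antisymmetry (N₁ N₂ : ℕ) (t : Word → Word → ℚ)
  (supported : ∀ u v → t u v ≢ 0ℚ → TwoLetter N₁ u × TwoLetter N₂ v)
  (balanced  : ∀ w → ∑ (deshuffles w) (λ (u , v) → t u v) ≡ 0ℚ) where

  S : Word → Word → ℚ
  S u v = t u v + t v u

  S₂ : ℕ → ℕ → ℕ → ℕ → ℚ
  S₂ a b c d = S (a ∷ b ∷ []) (c ∷ d ∷ [])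

  S₂-swap : ∀ a b c d → S₂ a b c d ≡ S₂ c d a b
  S₂-swap a b c d = ℚₚ.+-comm (t (a ∷ b ∷ []) (c ∷ d ∷ [])) _

  off-diagonal : ∀ u v → List.length u ≢ 2 → t u v ≡ 0ℚ
  off-diagonal u v ≢2 with t u v ℚ.≟ 0ℚ
  ... | yes t≡0 = t≡0
  ... | no  t≢0 = ⊥-elim (≢2 (proj₁ (proj₁ (supported u v t≢0))))

  pairings : ∀ a b c d → S₂ a b c d + S₂ a c b d + S₂ a d b c ≡ 0ℚ
  pairings a b c d =
    trans (sym (∑-deshuffles-four t off-diagonal a b c d)) (balanced (a ∷ b ∷ c ∷ d ∷ []))

  S-supported : ∀ u v → S u v ≢ 0ℚ →
                (TwoLetter N₁ u × TwoLetter N₂ v) ⊎ (TwoLetter N₂ u × TwoLetter N₁ v)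
  S-supported u v S≢0 with t u v ℚ.≟ 0ℚ
  ... | no  t≢0 = inj₁ (supported u v t≢0)
  ... | yes t≡0 = inj₂ (swap (supported v u λ t′≡0 →
                    S≢0 (trans (cong₂ _+_ t≡0 t′≡0) (ℚₚ.+-identityˡ 0ℚ))))

  pair-weights : ∀ {a b c d} → S₂ a b c d ≢ 0ℚ →
    (a ℕ.+ b ≡ N₁ × c ℕ.+ d ≡ N₂) ⊎ (a ℕ.+ b ≡ N₂ × c ℕ.+ d ≡ N₁)
  pair-weights {a} {b} {c} {d} S≢0 with S-supported (a ∷ b ∷ []) (c ∷ d ∷ []) S≢0
  ... | inj₁ ((_ , ab≡) , (_ , cd≡)) = inj₁ (trans (sym (sum-pair a b)) ab≡ , trans (sym (sum-pair c d)) cd≡)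
  ... | inj₂ ((_ , ab≡) , (_ , cd≡)) = inj₂ (trans (sym (sum-pair a b)) ab≡ , trans (sym (sum-pair c d)) cd≡)

  S₂-vanishes : ∀ {a b c d} x y z w → S₂ a b c d ≢ 0ℚ →
    x ℕ.+ y ≢ a ℕ.+ b → x ℕ.+ y ≢ c ℕ.+ d → S₂ x y z w ≡ 0ℚ
  S₂-vanishes x y z w S≢0 ≢ab ≢cd with S₂ x y z w ℚ.≟ 0ℚ
  ... | yes S′≡0 = S′≡0
  ... | no  S′≢0 with pair-weights S′≢0 | pair-weights S≢0
  ...   | inj₁ (xy≡N₁ , _) | inj₁ (ab≡N₁ , _)   = ⊥-elim (≢ab (trans xy≡N₁ (sym ab≡N₁)))
  ...   | inj₁ (xy≡N₁ , _) | inj₂ (_ , cd≡N₁)   = ⊥-elim (≢cd (trans xy≡N₁ (sym cd≡N₁)))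
  ...   | inj₂ (xy≡N₂ , _) | inj₁ (_ , cd≡N₂)   = ⊥-elim (≢cd (trans xy≡N₂ (sym cd≡N₂)))
  ...   | inj₂ (xy≡N₂ , _) | inj₂ (ab≡N₂ , _)   = ⊥-elim (≢ab (trans xy≡N₂ (sym ab≡N₂)))

  -- When S₂ a b c d ≢ 0 its halves have weights N₁ and N₂, so the other two pairings in
  -- pairings a b c d vanish unless letters coincide; coincidences are settled by the pairings of
  -- other words built from the same letters.
  S₂-zero-b≡c : ∀ a b c d → b ≡ c → S₂ a b c d ≢ 0ℚ → S₂ a b c d ≡ 0ℚ
  S₂-zero-b≡c a b c d refl S≢0 with b ℕ.≟ d | a ℕ.≟ b
  ... | yes refl | _        = x+x+x≡0⇒x≡0 (pairings a b b b) refl refl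
  ... | no  _    | yes refl = x+x+x≡0⇒x≡0 (pairings a a a d) refl (S₂-swap a d a a)
  ... | no  b≢d  | no  a≢b  =
    x+x+0≡0⇒x≡0 (pairings a b b d) refl (S₂-vanishes a d b b S≢0 (+-≢ˡ a (b≢d ∘ sym)) (+-≢ʳ d a≢b))

  S₂-zero-b≢c-a≢d : ∀ a b c d → b ≢ c → a ≢ d → S₂ a b c d ≢ 0ℚ → S₂ a b c d ≡ 0ℚ
  S₂-zero-b≢c-a≢d a b c d b≢c a≢d S≢0 with b ℕ.≟ d | a ℕ.≟ c
  ... | no  b≢d | no  a≢c =
    x+0+0≡0⇒x≡0 (pairings a b c d) (S₂-vanishes a c b d S≢0 (+-≢ˡ a (b≢c ∘ sym)) (+-≢-cross c a≢d))
                                   (S₂-vanishes a d b c S≢0 (+-≢ˡ a (b≢d ∘ sym)) (+-≢ʳ d a≢c))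
  ... | yes refl | no  a≢c =
    x+0+0≡0⇒x≡0 (pairings a b c b) acbb≡0 (x+x+0≡0⇒x≡0 (pairings a b b c) refl acbb≡0)
    where
    acbb≡0 : S₂ a c b b ≡ 0ℚ
    acbb≡0 = S₂-vanishes a c b b S≢0 (+-≢ˡ a (b≢c ∘ sym)) (+-≢-cross c a≢d)
  ... | no  b≢d | yes refl =
    0+x+x≡0⇒x≡0 (pairings a a b d) (S₂-vanishes a a b d S≢0 (+-≢ˡ a (b≢c ∘ sym)) (+-≢ˡ a a≢d))
                                   (S₂-swap a d a b)
  ... | yes refl | yes refl =
    0+x+x≡0⇒x≡0 (pairings a a b b) (S₂-vanishes a a b b S≢0 (+-≢ˡ a (b≢c ∘ sym)) (+-≢ˡ a (b≢c ∘ sym)))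
                                   refl

  S₂-zero : ∀ a b c d → S₂ a b c d ≡ 0ℚ
  S₂-zero a b c d with S₂ a b c d ℚ.≟ 0ℚ | b ℕ.≟ c | a ℕ.≟ d
  ... | yes S≡0 | _       | _       = S≡0
  ... | no  S≢0 | yes b≡c | _       = S₂-zero-b≡c a b c d b≡c S≢0
  ... | no  S≢0 | no  _   | yes a≡d =
    trans (S₂-swap a b c d) (S₂-zero-b≡c c d a b (sym a≡d) (S≢0 ∘ trans (S₂-swap a b c d)))
  ... | no  S≢0 | no  b≢c | no  a≢d = S₂-zero-b≢c-a≢d a b c d b≢c a≢d S≢0

  S-lengths : ∀ u v → S u v ≢ 0ℚ → List.length u ≡ 2 × List.length v ≡ 2
  S-lengths u v S≢0 with S-supported u v S≢0
  ... | inj₁ ((ℓu , _) , (ℓv , _)) = ℓu , ℓv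
  ... | inj₂ ((ℓu , _) , (ℓv , _)) = ℓu , ℓv

  antisymmetric : ∀ u v → t u v + t v u ≡ 0ℚ
  antisymmetric u v with S u v ℚ.≟ 0ℚ
  ... | yes S≡0 = S≡0
  ... | no  S≢0
    with two-letter-view u (proj₁ (S-lengths u v S≢0)) | two-letter-view v (proj₂ (S-lengths u v S≢0))
  ...   | a , b , refl | c , d , refl = S₂-zero a b c d

-- Independence and spanning

module _ {N₁ N₂ : ℕ} (B₁ B₂ : Subspace) (B₁⊆ : B₁ ⊆F[ N₁ , 2 ]) (B₂⊆ : B₂ ⊆F[ N₂ , 2 ])
         (disjoint : ∀ p → Mem B₁ p → Mem B₂ p → p ≈ 0F) where

  shuffleSum≈0⇒≈0 : ∀ {n} (xs ys : Vec Poly n) →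
    (∀ i → Mem B₁ (lookup xs i)) → (∀ i → Mem B₂ (lookup ys i)) → LinIndep xs →
    shuffleSum xs ys ≈ 0F → ∀ i → lookup ys i ≈ 0F
  shuffleSum≈0⇒≈0 xs ys xs∈B₁ ys∈B₂ xs-indep sum≈0 i v =
    trans (sym (Vecₚ.lookup-map i (λ p → coeff p v) ys)) (xs-indep (coeffsAt v ys) column≈0 i)
    where
    t : Word → Word → ℚ
    t u v = dot (coeffsAt u xs) (coeffsAt v ys)

    supported : ∀ u v → t u v ≢ 0ℚ → TwoLetter N₁ u × TwoLetter N₂ v
    supported u v t≢0 with dot-≢0 (coeffsAt u xs) (coeffsAt v ys) t≢0
    ... | j , xⱼ≢0 , yⱼ≢0 =
      two-letter (B₁⊆ _ (xs∈B₁ j) u (xⱼ≢0 ∘ trans (Vecₚ.lookup-map j _ xs))) ,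
      two-letter (B₂⊆ _ (ys∈B₂ j) v (yⱼ≢0 ∘ trans (Vecₚ.lookup-map j _ ys)))
      where
      two-letter : ∀ {N w} → AdmWord N 2 w → TwoLetter N w
      two-letter (ℓ , _ , Σ≡) = ℓ , Σ≡

    open Antisymmetry N₁ N₂ t supported (λ w → trans (sym (coeff-shuffleSum xs ys w)) (sum≈0 w))

    row≈-col : ∀ u → lincomb (coeffsAt u xs) ys ≈ ((- 1ℚ) ·F lincomb (coeffsAt u ys) xs)
    row≈-col u v = begin
      coeff (lincomb (coeffsAt u xs) ys) v         ≡⟨ coeff-lincomb (coeffsAt u xs) ys v ⟩
      t u v                                        ≡⟨ x+y≡0⇒x≡-1*y (t u v) (t v u) (antisymmetric u v) ⟩
      - 1ℚ * t v u                                 ≡⟨ cong (- 1ℚ *_) (dot-comm (coeffsAt v xs) _) ⟩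
      - 1ℚ * dot (coeffsAt u ys) (coeffsAt v xs)   ≡⟨ cong (- 1ℚ *_) (sym (coeff-lincomb (coeffsAt u ys) xs v)) ⟩
      - 1ℚ * coeff (lincomb (coeffsAt u ys) xs) v  ≡⟨ sym (coeff-·F (- 1ℚ) (lincomb (coeffsAt u ys) xs) v) ⟩
      coeff ((- 1ℚ) ·F lincomb (coeffsAt u ys) xs) v  ∎
      where open ≡-Reasoning

    row≈0 : ∀ u → lincomb (coeffsAt u xs) ys ≈ 0F
    row≈0 u = disjoint _
      (resp B₁ {(- 1ℚ) ·F lincomb (coeffsAt u ys) xs} (λ v → sym (row≈-col u v))
        (·∈ B₁ (- 1ℚ) (lincomb∈ B₁ (coeffsAt u ys) xs xs∈B₁)))
      (lincomb∈ B₂ (coeffsAt u xs) ys ys∈B₂)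

    column≈0 : lincomb (coeffsAt v ys) xs ≈ 0F
    column≈0 u = begin
      coeff (lincomb (coeffsAt v ys) xs) u      ≡⟨ coeff-lincomb (coeffsAt v ys) xs u ⟩
      dot (coeffsAt v ys) (coeffsAt u xs)       ≡⟨ dot-comm (coeffsAt v ys) _ ⟩
      t u v                                     ≡⟨ sym (coeff-lincomb (coeffsAt u xs) ys v) ⟩
      coeff (lincomb (coeffsAt u xs) ys) v      ≡⟨ row≈0 u v ⟩
      0ℚ                                        ∎
      where open ≡-Reasoning

  products-independent : ∀ {m n} (xs : Vec Poly m) (ys : Vec Poly n) →
    (∀ i → Mem B₁ (lookup xs i)) → (∀ j → Mem B₂ (lookup ys j)) → LinIndep xs → LinIndep ys →
    LinIndep (products xs ys)
  products-independent {m} {n} xs ys xs∈B₁ ys∈B₂ xs-indep ys-indep cs combination≈0 k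
    with Vec.group m n cs
  ... | C , refl = begin
    lookup (Vec.concat C) k                  ≡⟨ cong (lookup (Vec.concat C)) (sym (Finₚ.combine-remQuot {m} n k)) ⟩
    lookup (Vec.concat C) (combine i j)      ≡⟨ Vecₚ.lookup-concat C i j ⟩
    lookup (lookup C i) j                    ≡⟨ ys-indep (lookup C i) (row≈0 i) j ⟩
    0ℚ                                       ∎
    where
    open ≡-Reasoning
    i = quotient {m} n k
    j = remainder {m} n k
    rows : Vec Poly m
    rows = Vec.map (λ r → lincomb r ys) C
    rows∈B₂ : ∀ l → Mem B₂ (lookup rows l)
    rows∈B₂ l = subst (Mem B₂) (sym (Vecₚ.lookup-map l _ C)) (lincomb∈ B₂ (lookup C l) ys ys∈B₂)
    row≈0 : ∀ l → lincomb (lookup C l) ys ≈ 0F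
    row≈0 l w = trans (cong (λ p → coeff p w) (sym (Vecₚ.lookup-map l (λ r → lincomb r ys) C)))
      (shuffleSum≈0⇒≈0 xs rows xs∈B₁ rows∈B₂ xs-indep
        (λ w → trans (sym (lincomb-products C xs ys w)) (combination≈0 w)) l w)

ш∈ShSpan : ∀ (B₁ B₂ : Subspace) {x y} → Mem B₁ x → Mem B₂ y → ShSpan B₁ B₂ (x ш y)
ш∈ShSpan B₁ B₂ {x} {y} x∈B₁ y∈B₂ =
  1 , 1ℚ ∷ [] , x ∷ [] , y ∷ [] , (λ { zero → x∈B₁ }) , (λ { zero → y∈B₂ }) , λ w → sym (begin
    coeff ((1ℚ ·F (x ш y)) +F 0F) w  ≡⟨ coeff-+F (1ℚ ·F (x ш y)) 0F w ⟩
    coeff (1ℚ ·F (x ш y)) w + 0ℚ     ≡⟨ ℚₚ.+-identityʳ _ ⟩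
    coeff (1ℚ ·F (x ш y)) w          ≡⟨ coeff-·F 1ℚ (x ш y) w ⟩
    1ℚ * coeff (x ш y) w             ≡⟨ ℚₚ.*-identityˡ _ ⟩
    coeff (x ш y) w                  ∎)
  where open ≡-Reasoning

products-span : ∀ (B₁ B₂ : Subspace) {m n} (xs : Vec Poly m) (ys : Vec Poly n) →
  Spans (Mem B₁) xs → Spans (Mem B₂) ys → Spans (ShSpan B₁ B₂) (products xs ys)
products-span B₁ B₂ {m} {n} xs ys (xs∈B₁ , B₁⊆span) (ys∈B₂ , B₂⊆span) = products∈ , ShSpan⊆span
  where
  P : Subspace
  P = span (products xs ys)

  products∈ : ∀ k → ShSpan B₁ B₂ (lookup (products xs ys) k)
  products∈ k = subst (ShSpan B₁ B₂)
    (trans (sym (lookup-products xs ys (quotient {m} n k) (remainder {m} n k)))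
           (cong (lookup (products xs ys)) (Finₚ.combine-remQuot {m} n k)))
    (ш∈ShSpan B₁ B₂ (xs∈B₁ _) (ys∈B₂ _))

  ShSpan⊆span : ∀ p → ShSpan B₁ B₂ p → Mem P p
  ShSpan⊆span p (k , cs , as , bs , as∈B₁ , bs∈B₂ , p≈) =
    resp P {lincomb cs (Vec.zipWith _ш_ as bs)} {p} (λ w → sym (p≈ w))
      (lincomb∈ P cs _ λ l → subst (Mem P) (sym (Vecₚ.lookup-zipWith _ш_ l as bs))
        (ш∈span-products xs ys {lookup as l} {lookup bs l}
          (B₁⊆span _ (as∈B₁ l)) (B₂⊆span _ (bs∈B₂ l))))

lemma4p3 : (N₁ N₂ : ℕ) → 0 ℕ.< N₁ → 0 ℕ.< N₂ →
    (B₁ B₂ : Subspace) → B₁ ⊆F[ N₁ , 2 ] → B₂ ⊆F[ N₂ , 2 ] →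
    (∀ p → Mem B₁ p → Mem B₂ p → p ≈ 0F) →
    (d₁ d₂ : ℕ) → HasDim (Mem B₁) d₁ → HasDim (Mem B₂) d₂ →
    HasDim (ShSpan B₁ B₂) (d₁ ℕ.* d₂)
lemma4p3 N₁ N₂ _ _ B₁ B₂ B₁⊆ B₂⊆ disjoint d₁ d₂
         (b₁ , b₁-indep , b₁-spans) (b₂ , b₂-indep , b₂-spans) =
    products b₁ b₂
  , products-independent B₁ B₂ B₁⊆ B₂⊆ disjoint b₁ b₂ (proj₁ b₁-spans) (proj₁ b₂-spans) b₁-indep b₂-indep
  , products-span B₁ B₂ b₁ b₂ b₁-spans b₂-spans
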